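{- For every strongly connected, deterministic, circular, simple graph $G$, the cycle language $\mathrm{L}_G$ is a group presentation language.
   Context: A graph is a non-empty set $G\subseteq V\times A\times V$ of labelled edges $s\xrightarrow{a}t$ (for some label set $A$); $V_G$ is the set of vertices occurring in edges. $G$ is simple if $s\xrightarrow{a}t,\ s\xrightarrow{b}t\Rightarrow a=b$; deterministic if $r\xrightarrow{a}s,\ r\xrightarrow{a}t\Rightarrow s=t$; strongly connected if every vertex reaches every vertex by a directed path. For $u=a_1\cdots a_n\in A^*$, $s\xrightarrow{u}t$ means there is a path $s=s_0\xrightarrow{a_1}s_1\cdots\xrightarrow{a_n}s_n=t$; $\mathrm{L}_G(s,s)=\{u\mid s\xrightarrow{u}s\}$. $G$ is circular if $\mathrm{L}_G(s,s)=\mathrm{L}_G(t,t)$ for all $s,t$, with common value $\mathrm{L}_G$. For a language $L\subseteq A^*$, let $A_L=\{a\in A\mid\exists u,v\ (uav\in L)\}$; let $\leftrightarrow^*_L$ be the smallest equivalence on $A^*$ containing all pairs $(xuy,xy)$ with $u\in L$, $x,y\in A^*$ (the Thue congruence of $L$), and $[u]_L$ the class of $u$. $L$ is a group presentation language if (i) $A_L\neq\emptyset$; (ii) for every $a\in A_L$ there is $u\in A_L^*$ with $au,ua\in[\varepsilon]_L$; (iii) for all $a\neq b$ in $A_L$, $[a]_L\neq[b]_L$. -}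

module Defs where

open import Data.List using (List; []; _∷_; _++_)
open import Data.List.Relation.Unary.All using (All)
open import Data.Sum using (_⊎_)
open import Data.Product using (Σ; ∃; ∃-syntax; _×_; _,_)
open import Relation.Binary.PropositionalEquality using (_≡_)
open import Relation.Nullary using (¬_)

record Graph (V A : Set) : Set₁ where
  field
    Edge     : V → A → V → Set
    nonEmpty : ∃[ s ] ∃[ a ] ∃[ t ] Edge s a t

module _ {V A : Set} (G : Graph V A) where
  open Graph G

  Vertex : V → Set
  Vertex v = (∃[ a ] ∃[ t ] Edge v a t) ⊎ (∃[ s ] ∃[ a ] Edge s a v)

  data Path : V → List A → V → Set where
    [] : ∀ {s} → Path s [] s
    _∷_ : ∀ {s a t u r} → Edge s a t → Path t u r → Path s (a ∷ u) r

  IsSimple : Set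
  IsSimple = ∀ {s t a b} → Edge s a t → Edge s b t → a ≡ b

  IsDeterministic : Set
  IsDeterministic = ∀ {r s t a} → Edge r a s → Edge r a t → s ≡ t

  IsStronglyConnected : Set
  IsStronglyConnected = ∀ s t → Vertex s → Vertex t → ∃[ u ] Path s u t

  CycleLang : V → List A → Set
  CycleLang s u = Path s u s

  IsCircular : Set
  IsCircular = ∀ s t → Vertex s → Vertex t → ∀ u → (CycleLang s u → CycleLang t u) × (CycleLang t u → CycleLang s u)

Language : Set → Set₁
Language A = List A → Set

module _ {A : Set} (L : Language A) where

  Letter : A → Set
  Letter a = ∃[ u ] ∃[ v ] L (u ++ (a ∷ v))

  data ThueEq : List A → List A → Set where
    step  : ∀ x u y → L u → ThueEq (x ++ (u ++ y)) (x ++ y)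
    refl  : ∀ {w} → ThueEq w w
    sym   : ∀ {w w'} → ThueEq w w' → ThueEq w' w
    trans : ∀ {w w' w''} → ThueEq w w' → ThueEq w' w'' → ThueEq w w''

  IsGroupPresentationLanguage : Set
  IsGroupPresentationLanguage =
    (∃[ a ] Letter a)
    × (∀ a → Letter a → ∃[ u ] (All Letter u × ThueEq (a ∷ u) [] × ThueEq (u ++ (a ∷ [])) []))
    × (∀ a b → Letter a → Letter b → ¬ a ≡ b → ¬ ThueEq (a ∷ []) (b ∷ []))

-- Deleting or inserting a cycle u ∈ L_G(s,s) never changes which vertex a path
-- reaches: by circularity u is a cycle at every vertex, and by determinism the
-- path spelling u from a vertex is unique, hence that cycle.  So Thue-equivalent
-- words label paths between the same pairs of vertices.  Every letter a of L_G
-- labels an edge p -a-> q lying on a cycle; the return path q -w-> p gives the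
-- inverse w of a, and [a]_L = [b]_L yields an edge p -b-> q, so a = b by simplicity.
module Submission where

open import Defs
open import Data.List using (List; []; _∷_; _++_)
open import Data.List.Properties using (++-assoc; ++-identityʳ)
open import Data.List.Relation.Unary.All using (All; []; _∷_; tail)
open import Data.Sum using (inj₁; inj₂)
open import Data.Product using (∃-syntax; _×_; _,_; proj₁; proj₂)
open import Function.Bundles using (_⇔_; mk⇔; Equivalence)
open import Function.Properties.Equivalence using (⇔-isEquivalence)
open import Relation.Binary.PropositionalEquality using (_≡_; refl; subst)
import Relation.Binary.PropositionalEquality as ≡
open import Relation.Nullary using (¬_)
open import Relation.Binary.Structures using (IsEquivalence)

module ⇔ {ℓ} = IsEquivalence (⇔-isEquivalence {ℓ})

module _ {A : Set} (L : Language A) where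

  letters-of-suffix : ∀ x w → L (x ++ w) → All (Letter L) w
  letters-of-suffix x []      _ = []
  letters-of-suffix x (a ∷ w) h =
    (x , w , h) ∷ letters-of-suffix (x ++ a ∷ []) w (subst L (≡.sym (++-assoc x (a ∷ []) w)) h)

  member⇒letters : ∀ {w} → L w → All (Letter L) w
  member⇒letters = letters-of-suffix [] _

  member⇒ThueEq-[] : ∀ {w} → L w → ThueEq L w []
  member⇒ThueEq-[] {w} h = subst (λ z → ThueEq L z []) (++-identityʳ w) (step [] w [] h)

module _ {V A : Set} (G : Graph V A) where
  open Graph G

  source-vertex : ∀ {p a q} → Edge p a q → Vertex G p
  source-vertex e = inj₁ (_ , _ , e)

  target-vertex : ∀ {p a q} → Edge p a q → Vertex G q
  target-vertex e = inj₂ (_ , _ , e)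

  path-++ : ∀ {v x r y t} → Path G v x r → Path G r y t → Path G v (x ++ y) t
  path-++ []      q = q
  path-++ (e ∷ p) q = e ∷ path-++ p q

  path-split : ∀ {v t} x {y} → Path G v (x ++ y) t → ∃[ r ] (Path G v x r × Path G r y t)
  path-split []      p       = _ , [] , p
  path-split (a ∷ x) (e ∷ p) with path-split x p
  ... | r , px , py = r , e ∷ px , py

  path-target-vertex : ∀ {v x t} → Path G v x t → Vertex G v → Vertex G t
  path-target-vertex []      hv = hv
  path-target-vertex (e ∷ p) _  = path-target-vertex p (target-vertex e)

  path-deterministic : IsDeterministic G → ∀ {r u t t′} → Path G r u t → Path G r u t′ → t ≡ t′
  path-deterministic det []      []        = refl
  path-deterministic det (e ∷ p) (e′ ∷ p′) with det e e′
  ... | refl = path-deterministic det p p′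

  module _ (circ : IsCircular G) {s} (hs : Vertex G s) {u : List A} where

    cycle-to : ∀ {r} → Vertex G r → CycleLang G r u → CycleLang G s u
    cycle-to hr = proj₁ (circ _ s hr hs u)

    cycle-from : ∀ {r} → Vertex G r → CycleLang G s u → CycleLang G r u
    cycle-from hr = proj₂ (circ _ s hr hs u)

  _≈ₚ_ : List A → List A → Set
  w ≈ₚ w′ = ∀ {v t} → Vertex G v → Path G v w t ⇔ Path G v w′ t

  cycle-deletion : IsDeterministic G → ∀ {u} → (∀ {r} → Vertex G r → CycleLang G r u)
                 → ∀ x y → (x ++ u ++ y) ≈ₚ (x ++ y)
  cycle-deletion det {u} cycle x y {v} {t} hv = mk⇔ delete insert
    where
    delete : Path G v (x ++ u ++ y) t → Path G v (x ++ y) t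
    delete p with path-split x p
    ... | _ , px , puy with path-split u puy
    ... | _ , pu , py with path-deterministic det (cycle (path-target-vertex px hv)) pu
    ... | refl = path-++ px py

    insert : Path G v (x ++ y) t → Path G v (x ++ u ++ y) t
    insert p with path-split x p
    ... | _ , px , py = path-++ px (path-++ (cycle (path-target-vertex px hv)) py)

  ThueEq⇒≈ₚ : IsDeterministic G → IsCircular G → ∀ {s} → Vertex G s
            → ∀ {w w′} → ThueEq (CycleLang G s) w w′ → w ≈ₚ w′
  ThueEq⇒≈ₚ det circ hs (step x u y c) = cycle-deletion det (λ hr → cycle-from circ hs hr c) x y
  ThueEq⇒≈ₚ det circ hs refl           = λ _ → ⇔.refl
  ThueEq⇒≈ₚ det circ hs (sym h)        = λ hv → ⇔.sym (ThueEq⇒≈ₚ det circ hs h hv)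
  ThueEq⇒≈ₚ det circ hs (trans h h′)   =
    λ hv → ⇔.trans (ThueEq⇒≈ₚ det circ hs h hv) (ThueEq⇒≈ₚ det circ hs h′ hv)

  letter⇒edge-on-cycle : ∀ {s a} → Letter (CycleLang G s) a
                       → ∃[ p ] ∃[ q ] (Edge p a q × ∃[ w ] Path G q w p)
  letter⇒edge-on-cycle (x , y , c) with path-split x c
  ... | p , px , e ∷ py = p , _ , e , y ++ x , path-++ py px

lemma4p5 : {V A : Set} (G : Graph V A) → IsStronglyConnected G → IsDeterministic G → IsCircular G → IsSimple G
    → ∀ s → Vertex G s → IsGroupPresentationLanguage (CycleLang G s)
lemma4p5 G sc det circ simp s hs = some-letter , inverse , distinct
  where
  open Graph G
  L = CycleLang G s

  edge-cycle : ∀ {p a q w} → Edge p a q → Path G q w p → L (a ∷ w)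
  edge-cycle e pw = cycle-to G circ hs (source-vertex G e) (e ∷ pw)

  some-letter : ∃[ a ] Letter L a
  some-letter with nonEmpty
  ... | p , a , q , e with sc q p (target-vertex G e) (source-vertex G e)
  ... | w , pw = a , [] , w , edge-cycle e pw

  inverse : ∀ a → Letter L a → ∃[ u ] (All (Letter L) u × ThueEq L (a ∷ u) [] × ThueEq L (u ++ a ∷ []) [])
  inverse a la with letter⇒edge-on-cycle G la
  ... | _ , _ , e , w , pw =
    w , tail (member⇒letters L (edge-cycle e pw))
      , member⇒ThueEq-[] L (edge-cycle e pw)
      , member⇒ThueEq-[] L (cycle-to G circ hs (target-vertex G e) (path-++ G pw (e ∷ [])))

  distinct : ∀ a b → Letter L a → Letter L b → ¬ a ≡ b → ¬ ThueEq L (a ∷ []) (b ∷ [])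
  distinct a b la _ a≢b h with letter⇒edge-on-cycle G la
  ... | _ , _ , e , _ with Equivalence.to (ThueEq⇒≈ₚ G det circ hs h (source-vertex G e)) (e ∷ [])
  ... | e′ ∷ [] = a≢b (simp e e′)
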